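{- Let $n,k,\ell,t$ be positive integers with $n\geq k+\ell$, and let $\mathcal{F}\subseteq\binom{[n]}{k}$ and $\mathcal{G}\subseteq\binom{[n]}{\ell}$ be maximal cross $t$-intersecting families. Let $\mathcal{T}_f$ be the set of $t$-covers of $\mathcal{F}$ of size $\tau_t(\mathcal{F})$, and $\mathcal{T}_g$ the set of $t$-covers of $\mathcal{G}$ of size $\tau_t(\mathcal{G})$. Then $\mathcal{T}_f$ and $\mathcal{T}_g$ are cross $t$-intersecting, i.e. $|T_f\cap T_g|\geq t$ for all $T_f\in\mathcal{T}_f$, $T_g\in\mathcal{T}_g$.
   Context: $[n]=\{1,\dots,n\}$; $\binom{[n]}{k}$ is the family of $k$-subsets of $[n]$. Families $\mathcal{F}$, $\mathcal{G}$ are cross $t$-intersecting if $|F\cap G|\geq t$ for all $F\in\mathcal{F}$, $G\in\mathcal{G}$; a cross $t$-intersecting pair $\mathcal{F}\subseteq\binom{[n]}{k}$, $\mathcal{G}\subseteq\binom{[n]}{\ell}$ is maximal if for any cross $t$-intersecting $\mathcal{F}'\subseteq\binom{[n]}{k}$, $\mathcal{G}'\subseteq\binom{[n]}{\ell}$ with $\mathcal{F}\subseteq\mathcal{F}'$, $\mathcal{G}\subseteq\mathcal{G}'$ one has $\mathcal{F}'=\mathcal{F}$, $\mathcal{G}'=\mathcal{G}$. A $t$-cover of a family $\mathcal{F}$ is a set $T\subseteq[n]$ with $|T\cap F|\geq t$ for all $F\in\mathcal{F}$; $\tau_t(\mathcal{F})$ is the minimum size of a $t$-cover of $\mathcal{F}$.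 -}

module Defs where

open import Data.Nat using (ℕ; _≤_)
open import Data.Fin.Subset using (Subset; ∣_∣; _∩_)
open import Data.Product using (∃)
open import Relation.Binary.PropositionalEquality using (_≡_)

Family : ℕ → Set₁
Family n = Subset n → Set

Uniform : {n : ℕ} → ℕ → Family n → Set
Uniform k 𝓕 = ∀ A → 𝓕 A → ∣ A ∣ ≡ k

_⊆ᶠ_ : {n : ℕ} → Family n → Family n → Set
𝓕 ⊆ᶠ 𝓕′ = ∀ A → 𝓕 A → 𝓕′ A

_≡ᶠ_ : {n : ℕ} → Family n → Family n → Set
𝓕 ≡ᶠ 𝓕′ = (𝓕 ⊆ᶠ 𝓕′) Data.Product.× (𝓕′ ⊆ᶠ 𝓕)
  where import Data.Product

NonEmpty : {n : ℕ} → Family n → Set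
NonEmpty 𝓕 = ∃ λ A → 𝓕 A

CrossInt : {n : ℕ} → ℕ → Family n → Family n → Set
CrossInt t 𝓕 𝓖 = ∀ F G → 𝓕 F → 𝓖 G → t ≤ ∣ F ∩ G ∣

MaximalCrossInt : (n k ℓ t : ℕ) → Family n → Family n → Set₁
MaximalCrossInt n k ℓ t 𝓕 𝓖 =
  Uniform k 𝓕 Data.Product.× Uniform ℓ 𝓖 Data.Product.× CrossInt t 𝓕 𝓖 Data.Product.×
  (∀ (𝓕′ 𝓖′ : Family n) → Uniform k 𝓕′ → Uniform ℓ 𝓖′ → CrossInt t 𝓕′ 𝓖′ →
     𝓕 ⊆ᶠ 𝓕′ → 𝓖 ⊆ᶠ 𝓖′ → (𝓕′ ≡ᶠ 𝓕) Data.Product.× (𝓖′ ≡ᶠ 𝓖))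
  where import Data.Product

IsCover : {n : ℕ} → ℕ → Family n → Subset n → Set
IsCover t 𝓕 T = ∀ F → 𝓕 F → t ≤ ∣ T ∩ F ∣

-- T is a t-cover of 𝓕 of size τ_t(𝓕), i.e. a t-cover of minimum size
IsMinCover : {n : ℕ} → ℕ → Family n → Subset n → Set
IsMinCover t 𝓕 T = IsCover t 𝓕 T Data.Product.× (∀ T′ → IsCover t 𝓕 T′ → ∣ T ∣ ≤ ∣ T′ ∣)
  where import Data.Product

{-# OPTIONS --safe #-}
module Submission where

open import Defs
open import Data.Nat using (ℕ; zero; suc; z≤n; s≤s; _+_; _∸_; _≤_; _<_)
open import Data.Nat.Properties
  using (≤-trans; ≤-pred; _≤?_; ≰⇒>; ∸-monoʳ-≤; m+n≤o⇒m≤o∸n; module ≤-Reasoning)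
open import Data.Fin.Subset using (Subset; ∣_∣; _⊆_; _∩_; _∪_; ∁; inside; outside)
open import Data.Fin.Subset.Properties
  using (p⊆q⇒∣p∣≤∣q∣; out⊆; in⊆in; drop-∷-⊆; ⊆-refl; p⊆p∪q; q⊆p∪q; ∩-comm;
         x∈p∩q⁺; x∈p∩q⁻; x∈p∪q⁻; x∈∁p⇒x∉p; ∣∁p∣≡n∸∣p∣)
open import Data.Vec using ([]; _∷_; here)
open import Data.Product using (∃; _×_; _,_; proj₁)
open import Data.Sum using (_⊎_; inj₁; inj₂)
open import Relation.Nullary using (yes; no; contradiction)
open import Relation.Binary.PropositionalEquality using (_≡_; refl; cong; subst)

-- Every member of 𝓕 is a t-cover of 𝓖, so |Tg| ≤ k, and likewise
-- |Tf| ≤ ℓ. Since n ≥ k + ℓ, the set Tg ∪ ∁ Tf has at least k elements, so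
-- some k-set S satisfies Tg ⊆ S ⊆ Tg ∪ ∁ Tf. As a superset of Tg, S is a
-- t-cover of 𝓖, hence maximality forces S ∈ 𝓕. Then Tf covers S, and
-- Tf ∩ S ⊆ Tf ∩ Tg gives t ≤ |Tf ∩ Tg|.

⊆-interpolate : ∀ {n} (A B : Subset n) → A ⊆ B → ∀ m → ∣ A ∣ ≤ m → m ≤ ∣ B ∣ →
                ∃ λ S → A ⊆ S × S ⊆ B × ∣ S ∣ ≡ m
⊆-interpolate [] [] _ zero _ _ = [] , ⊆-refl , ⊆-refl , refl
⊆-interpolate (inside ∷ A) (outside ∷ B) A⊆B m _ _ = contradiction (A⊆B here) λ ()
⊆-interpolate (outside ∷ A) (outside ∷ B) A⊆B m A≤m m≤B
  with S , A⊆S , S⊆B , ∣S∣≡m ← ⊆-interpolate A B (drop-∷-⊆ A⊆B) m A≤m m≤B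
  = outside ∷ S , out⊆ A⊆S , out⊆ S⊆B , ∣S∣≡m
⊆-interpolate (inside ∷ A) (inside ∷ B) A⊆B (suc m) (s≤s A≤m) (s≤s m≤B)
  with S , A⊆S , S⊆B , ∣S∣≡m ← ⊆-interpolate A B (drop-∷-⊆ A⊆B) m A≤m m≤B
  = inside ∷ S , in⊆in A⊆S , in⊆in S⊆B , cong suc ∣S∣≡m
⊆-interpolate (outside ∷ A) (inside ∷ B) A⊆B m A≤m m≤1+B with m ≤? ∣ B ∣
... | yes m≤B
  with S , A⊆S , S⊆B , ∣S∣≡m ← ⊆-interpolate A B (drop-∷-⊆ A⊆B) m A≤m m≤B
  = outside ∷ S , out⊆ A⊆S , out⊆ S⊆B , ∣S∣≡m
⊆-interpolate (outside ∷ A) (inside ∷ B) A⊆B zero A≤m m≤1+B | no m≰B =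
  contradiction z≤n m≰B
⊆-interpolate (outside ∷ A) (inside ∷ B) A⊆B (suc m) A≤m (s≤s m≤B) | no m≰B
  with S , A⊆S , S⊆B , ∣S∣≡m ← ⊆-interpolate A B (drop-∷-⊆ A⊆B) m
         (≤-trans (p⊆q⇒∣p∣≤∣q∣ (drop-∷-⊆ A⊆B)) (≤-pred (≰⇒> m≰B))) m≤B
  = inside ∷ S , out⊆ A⊆S , in⊆in S⊆B , cong suc ∣S∣≡m

∩-monoˡ-⊆ : ∀ {n} {p q : Subset n} (r : Subset n) → p ⊆ q → p ∩ r ⊆ q ∩ r
∩-monoˡ-⊆ {p = p} r p⊆q x∈p∩r with x∈p , x∈r ← x∈p∩q⁻ p r x∈p∩r =
  x∈p∩q⁺ (p⊆q x∈p , x∈r)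

q⊆r∪∁p⇒p∩q⊆p∩r : ∀ {n} (p q r : Subset n) → q ⊆ r ∪ ∁ p → p ∩ q ⊆ p ∩ r
q⊆r∪∁p⇒p∩q⊆p∩r p q r q⊆r∪∁p x∈p∩q with x∈p , x∈q ← x∈p∩q⁻ p q x∈p∩q
  with x∈p∪q⁻ r (∁ p) (q⊆r∪∁p x∈q)
... | inj₁ x∈r  = x∈p∩q⁺ (x∈p , x∈r)
... | inj₂ x∈∁p = contradiction x∈p (x∈∁p⇒x∉p x∈∁p)

n∸∣q∣≤∣p∪∁q∣ : ∀ {n} (p q : Subset n) → n ∸ ∣ q ∣ ≤ ∣ p ∪ ∁ q ∣
n∸∣q∣≤∣p∪∁q∣ p q =
  subst (_≤ ∣ p ∪ ∁ q ∣) (∣∁p∣≡n∸∣p∣ q) (p⊆q⇒∣p∣≤∣q∣ (q⊆p∪q p (∁ q)))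

module _ {n t : ℕ} where

  CrossInt-sym : {𝓕 𝓖 : Family n} → CrossInt t 𝓕 𝓖 → CrossInt t 𝓖 𝓕
  CrossInt-sym cross G F G∈𝓖 F∈𝓕 =
    subst (λ X → t ≤ ∣ X ∣) (∩-comm F G) (cross F G F∈𝓕 G∈𝓖)

  IsCover-⊆ : {𝓕 : Family n} {T S : Subset n} → T ⊆ S → IsCover t 𝓕 T → IsCover t 𝓕 S
  IsCover-⊆ T⊆S cover F F∈𝓕 =
    ≤-trans (cover F F∈𝓕) (p⊆q⇒∣p∣≤∣q∣ (∩-monoˡ-⊆ F T⊆S))

  ∣minCover∣≤ : {k : ℕ} {𝓕 𝓖 : Family n} {T : Subset n} →
                Uniform k 𝓕 → NonEmpty 𝓕 → CrossInt t 𝓕 𝓖 → IsMinCover t 𝓖 T → ∣ T ∣ ≤ k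
  ∣minCover∣≤ uniform (F , F∈𝓕) cross (_ , minimal) =
    subst (_ ≤_) (uniform F F∈𝓕) (minimal F λ G G∈𝓖 → cross F G F∈𝓕 G∈𝓖)

  maximal⇒cover∈ : {k ℓ : ℕ} {𝓕 𝓖 : Family n} {S : Subset n} →
                   MaximalCrossInt n k ℓ t 𝓕 𝓖 → ∣ S ∣ ≡ k → IsCover t 𝓖 S → 𝓕 S
  maximal⇒cover∈ {k} {𝓕 = 𝓕} {𝓖} {S} (uniform𝓕 , uniform𝓖 , cross , maximal) ∣S∣≡k S-covers =
    proj₁ (proj₁ (maximal 𝓕+S 𝓖 uniform𝓕+S uniform𝓖 cross𝓕+S (λ _ → inj₁) (λ _ G∈𝓖 → G∈𝓖)))
      S (inj₂ refl)
    where
    𝓕+S : Family n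
    𝓕+S A = 𝓕 A ⊎ A ≡ S

    uniform𝓕+S : Uniform k 𝓕+S
    uniform𝓕+S A (inj₁ A∈𝓕) = uniform𝓕 A A∈𝓕
    uniform𝓕+S A (inj₂ refl) = ∣S∣≡k

    cross𝓕+S : CrossInt t 𝓕+S 𝓖
    cross𝓕+S F G (inj₁ F∈𝓕) G∈𝓖 = cross F G F∈𝓕 G∈𝓖
    cross𝓕+S F G (inj₂ refl) G∈𝓖 = S-covers G G∈𝓖

lemma3p1 : (n k ℓ t : ℕ) → 0 < k → 0 < ℓ → 0 < t → k + ℓ ≤ n →
    (𝓕 𝓖 : Family n) → NonEmpty 𝓕 → NonEmpty 𝓖 → MaximalCrossInt n k ℓ t 𝓕 𝓖 →
    ∀ (Tf Tg : Subset n) → IsMinCover t 𝓕 Tf → IsMinCover t 𝓖 Tg → t ≤ ∣ Tf ∩ Tg ∣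
lemma3p1 n k ℓ t _ _ _ k+ℓ≤n 𝓕 𝓖 𝓕≠∅ 𝓖≠∅ maximal@(uniform𝓕 , uniform𝓖 , cross , _)
         Tf Tg minTf@(Tf-covers , _) minTg@(Tg-covers , _) =
  let ∣Tg∣≤k : ∣ Tg ∣ ≤ k
      ∣Tg∣≤k = ∣minCover∣≤ {T = Tg} uniform𝓕 𝓕≠∅ cross minTg
      ∣Tf∣≤ℓ : ∣ Tf ∣ ≤ ℓ
      ∣Tf∣≤ℓ = ∣minCover∣≤ {T = Tf} uniform𝓖 𝓖≠∅ (CrossInt-sym cross) minTf
      k≤∣Tg∪∁Tf∣ : k ≤ ∣ Tg ∪ ∁ Tf ∣
      k≤∣Tg∪∁Tf∣ = begin
        k           ≤⟨ m+n≤o⇒m≤o∸n k k+ℓ≤n ⟩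
        n ∸ ℓ       ≤⟨ ∸-monoʳ-≤ n ∣Tf∣≤ℓ ⟩
        n ∸ ∣ Tf ∣  ≤⟨ n∸∣q∣≤∣p∪∁q∣ Tg Tf ⟩
        ∣ Tg ∪ ∁ Tf ∣ ∎
      S , Tg⊆S , S⊆Tg∪∁Tf , ∣S∣≡k =
        ⊆-interpolate Tg (Tg ∪ ∁ Tf) (p⊆p∪q (∁ Tf)) k ∣Tg∣≤k k≤∣Tg∪∁Tf∣
      S∈𝓕 : 𝓕 S
      S∈𝓕 = maximal⇒cover∈ maximal ∣S∣≡k (IsCover-⊆ Tg⊆S Tg-covers)
  in ≤-trans (Tf-covers S S∈𝓕) (p⊆q⇒∣p∣≤∣q∣ (q⊆r∪∁p⇒p∩q⊆p∩r Tf S Tg S⊆Tg∪∁Tf))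
  where open ≤-Reasoning
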